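{- The monoid $(\mathrm{PT},\cdot,(-)^*,\bar\epsilon)$ is an $E$-unitary inverse monoid.
   Context: A tree is a nonempty prefix-closed finitely branching set $A\subseteq(\mathbb N^+)^*$ with $wj\in A$, $i<j$ implying $wi\in A$. A permutation tree is a map $t:A\to\mathrm{Sym}(\mathbb N^+)$ (possibly infinite) such that a node with exactly $n$ children has label in $S_n$ (permutations of $\mathbb N^+$ fixing all $i>n$). Write $t=\langle\pi;t_1,..,t_n\rangle$ (root label $\pi$, subtrees $t_i$); $\bar\epsilon$ is the one-node tree. $\mathrm{PT}$ is the set of permutation trees. Product (coinductive): $t\bar\epsilon=t=\bar\epsilon t$; for $t=\langle\pi;t_1..t_n\rangle$, $u=\langle\rho;u_1..u_m\rangle$: if $n\ge m$, $tu=\langle\pi\circ\rho;u_1t_{\rho1},..,u_mt_{\rho m},t_{m+1},..,t_n\rangle$; if $m\ge n$, $tu=\langle\pi\circ\rho;u_1t_{\rho1},..,u_mt_{\rho m}\rangle$ with $t_j:=\bar\epsilon$ for $j>n$. $\bar\epsilon^*=\bar\epsilon$, $t^*=\langle\pi^{ -1};(t_{\pi^{ -1}1})^*,..,(t_{\pi^{ -1}n})^*\rangle$. An inverse monoid is a monoid with unary $^*$ satisfying $(u^*)^*=u$, $(uv)^*=v^*u^*$, $uu^*u=u$, $uu^*vv^*=vv^*uu^*$; natural order $u\le v$ iff $uu^*v=u$; it is $E$-unitary if whenever $e$ is idempotent and $e\le v$ then $v$ is idempotent. -}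

module Defs where

open import Data.Nat as ℕ using (ℕ; zero; suc; _<_; _≤_; _<?_; _⊔_)
open import Data.Nat.Properties using (m≤m⊔n; m≤n⊔m)
open import Data.Fin as Fin using (Fin; toℕ; fromℕ<; inject≤; cast)
open import Data.Fin.Properties using (toℕ-injective; toℕ-fromℕ<; toℕ-inject≤; toℕ<n)
open import Data.Fin.Permutation as P using (Permutation′; _⟨$⟩ʳ_; _⟨$⟩ˡ_; _∘ₚ_; flip; permutation; inverseˡ; inverseʳ)
open import Data.List using (List; []; _∷_)
open import Data.Product using (Σ; _×_; _,_; proj₁; proj₂)
open import Data.Unit using (⊤)
open import Relation.Nullary using (yes; no; contradiction)
open import Relation.Binary.PropositionalEquality using (_≡_; refl; sym; trans; cong)
open import Algebra.Structures using (IsMonoid)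

-- Extending a permutation of Fin n (an element of S_n) to Fin k, k ≥ n,
-- by fixing every index ≥ n.  (Indices are 0-based: Fin n = {0..n-1}
-- stands for {1..n}.)

ext-fun : {n k : ℕ} → n ≤ k → (Fin n → Fin n) → Fin k → Fin k
ext-fun {n} le f i with toℕ i <? n
... | yes p = inject≤ (f (fromℕ< p)) le
... | no _  = i

ext-inv : {n k : ℕ} (le : n ≤ k) (f g : Fin n → Fin n) →
          (∀ j → g (f j) ≡ j) → ∀ i → ext-fun le g (ext-fun le f i) ≡ i
ext-inv {n} le f g gf i with toℕ i <? n
... | yes p with toℕ (inject≤ (f (fromℕ< p)) le) <? n
...   | yes q = toℕ-injective (begin′)
  where
    eq1 : fromℕ< q ≡ f (fromℕ< p)
    eq1 = toℕ-injective (trans (toℕ-fromℕ< q) (toℕ-inject≤ (f (fromℕ< p)) le))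
    begin′ : toℕ (inject≤ (g (fromℕ< q)) le) ≡ toℕ i
    begin′ = trans (toℕ-inject≤ (g (fromℕ< q)) le)
               (trans (cong (λ x → toℕ (g x)) eq1)
                 (trans (cong toℕ (gf (fromℕ< p))) (toℕ-fromℕ< p)))
...   | no ¬q = contradiction
                 (Data.Nat.Properties.≤-trans
                   (ℕ.s≤s (Data.Nat.Properties.≤-reflexive (toℕ-inject≤ (f (fromℕ< p)) le)))
                   (toℕ<n (f (fromℕ< p))))
                 ¬q
  where import Data.Nat.Properties
ext-inv {n} le f g gf i | no ¬p with toℕ i <? n
... | yes p = contradiction p ¬p
... | no _  = refl

ext : {n k : ℕ} → n ≤ k → Permutation′ n → Permutation′ k
ext le π = permutation (ext-fun le (π ⟨$⟩ʳ_)) (ext-fun le (π ⟨$⟩ˡ_))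
  (ext-inv le (π ⟨$⟩ˡ_) (π ⟨$⟩ʳ_) (λ j → inverseʳ π))
  (ext-inv le (π ⟨$⟩ʳ_) (π ⟨$⟩ˡ_) (λ j → inverseˡ π))

act : {n : ℕ} → Permutation′ n → ℕ → ℕ
act {n} π i with i <? n
... | yes p = toℕ (π ⟨$⟩ʳ fromℕ< p)
... | no _  = i

-- A permutation tree t : A → Sym(ℕ⁺) is represented by giving, for every
-- word w ∈ ℕ* (0-based child indices), an arity and a label in S_(arity).
-- The node set A of t is the set of words w = i₁…iₖ such that each iⱼ is
-- smaller than the arity of the node i₁…iⱼ₋₁ (so A is nonempty,
-- prefix-closed, finitely branching, and closed under smaller siblings).
-- Values at words outside A are irrelevant: equality of trees (_≈T_)
-- only inspects nodes of A.  Possibly infinite trees are allowed.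

record PT : Set where
  field
    arity : List ℕ → ℕ
    label : (w : List ℕ) → Permutation′ (arity w)
open PT public

ε̄ : PT
arity ε̄ _ = 0
label ε̄ _ = P.id

shift : PT → ℕ → PT
arity (shift t i) w = arity t (i ∷ w)
label (shift t i) w = label t (i ∷ w)

sub : PT → ℕ → PT
sub t i with i <? arity t []
... | yes _ = shift t i
... | no _  = ε̄

_∈T_ : List ℕ → PT → Set
[] ∈T t = ⊤
(i ∷ w) ∈T t = (i < arity t []) × (w ∈T shift t i)

_≈T_ : PT → PT → Set
t ≈T u = ∀ w → w ∈T t →
  Σ (arity t w ≡ arity u w) λ e →
    ∀ j → toℕ (label t w ⟨$⟩ʳ j) ≡ toℕ (label u w ⟨$⟩ʳ cast e j)

-- Unfolding the coinductive definition, the subtree of t·u at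
-- a word w is again a product l·r of subtrees l, r; 'factors' computes
-- this pair.  Root of t = ⟨π;t₁..tₙ⟩, u = ⟨ρ;u₁..uₘ⟩:
--   (tu)_i = u_i · t_(ρ i)   (with t_j = ε̄ for j > n, u_i = ε̄ for i > m,
--                              and ε̄ · s = s, ρ i = i for i > m)
-- label of tu is π∘ρ on {1..max n m}.

factors : PT → PT → List ℕ → PT × PT
factors t u [] = t , u
factors t u (i ∷ w) = factors (sub u i) (sub t (act (label u []) i)) w

rootLabel : (t u : PT) → Permutation′ (arity t [] ⊔ arity u [])
rootLabel t u = ext (m≤n⊔m (arity t []) (arity u [])) (label u [])
                  ∘ₚ ext (m≤m⊔n (arity t []) (arity u [])) (label t [])
-- (ρ ∘ₚ π) ⟨$⟩ʳ i = π ⟨$⟩ʳ (ρ ⟨$⟩ʳ i), i.e. this is π∘ρ.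

infixl 7 _·_
_·_ : PT → PT → PT
arity (t · u) w = arity (proj₁ (factors t u w)) [] ⊔ arity (proj₂ (factors t u w)) []
label (t · u) w = rootLabel (proj₁ (factors t u w)) (proj₂ (factors t u w))

-- Inverse: t* = ⟨π⁻¹; (t_(π⁻¹ 1))*, …, (t_(π⁻¹ n))*⟩.  The subtree of t*
-- at w is (s)* for the subtree s of t computed by 'invFactor'.
invFactor : PT → List ℕ → PT
invFactor t [] = t
invFactor t (i ∷ w) = invFactor (sub t (act (flip (label t [])) i)) w

infix 8 _*
_* : PT → PT
arity (t *) w = arity (invFactor t w) []
label (t *) w = flip (label (invFactor t w) [])

record IsInverseMonoid {A : Set} (_≈_ : A → A → Set) (_∙_ : A → A → A)
                       (_⋆ : A → A) (e : A) : Set where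
  field
    isMonoid    : IsMonoid _≈_ _∙_ e
    ⋆-cong      : ∀ {u v} → u ≈ v → (u ⋆) ≈ (v ⋆)
    involution  : ∀ u → ((u ⋆) ⋆) ≈ u
    antihom     : ∀ u v → ((u ∙ v) ⋆) ≈ ((v ⋆) ∙ (u ⋆))
    regular     : ∀ u → ((u ∙ (u ⋆)) ∙ u) ≈ u
    idem-comm   : ∀ u v → ((u ∙ (u ⋆)) ∙ (v ∙ (v ⋆))) ≈ ((v ∙ (v ⋆)) ∙ (u ∙ (u ⋆)))

NatLe : {A : Set} (_≈_ : A → A → Set) (_∙_ : A → A → A) (_⋆ : A → A) → A → A → Set
NatLe _≈_ _∙_ _⋆ u v = ((u ∙ (u ⋆)) ∙ v) ≈ u

IsIdempotentElt : {A : Set} (_≈_ : A → A → Set) (_∙_ : A → A → A) → A → Set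
IsIdempotentElt _≈_ _∙_ e = (e ∙ e) ≈ e

record IsEUnitaryInverseMonoid {A : Set} (_≈_ : A → A → Set) (_∙_ : A → A → A)
                               (_⋆ : A → A) (e : A) : Set where
  field
    isInverseMonoid : IsInverseMonoid _≈_ _∙_ _⋆ e
    eUnitary : ∀ f v → IsIdempotentElt _≈_ _∙_ f → NatLe _≈_ _∙_ _⋆ f v →
               IsIdempotentElt _≈_ _∙_ v

-- Equality of permutation trees is checked node by node, so each law is proved by a
-- bisimulation: a family of pairs of trees whose roots agree and whose subtrees are again
-- (up to ≈T) pairs of the family.  The subtree of t·u below child i is u_i · t_(ρ i) and
-- the subtree of t* below i is (t_(π⁻¹ i))*, so the families close up; at the root, where
-- the label of t·u is π∘ρ, every law reduces to a law of permutations of ℕ.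
-- The idempotents are exactly the trees all of whose labels are identities.  Such trees
-- commute, and if g·v = h with g and h of this kind then the root label of v is the identity
-- and each subtree v_i satisfies g_i·v_i = h_i or v_i·g_i = h_i; hence all labels of v are
-- identities.  Applied to (f f*)·v = f this is E-unitarity.
module Submission where

open import Defs
open import Data.Nat using (ℕ; _<_; _≤_; _<?_; _⊔_)
open import Data.Nat.Properties using (m≤m⊔n; m≤n⊔m; ⊔-comm; ⊔-assoc; ⊔-idem; ⊔-identityʳ; <-≤-trans)
open import Data.Fin using (Fin; toℕ; fromℕ<; cast)
open import Data.Fin.Properties using (toℕ-fromℕ<; toℕ-inject≤; toℕ<n; fromℕ<-toℕ; cast-is-id)
open import Data.Fin.Permutation as P using (Permutation′; _⟨$⟩ʳ_; _∘ₚ_; flip; inverseˡ)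
open import Data.List using (List; []; _∷_)
open import Data.Product using (Σ; _×_; _,_; proj₁; proj₂)
open import Data.Unit using (tt)
open import Relation.Nullary using (¬_; yes; no; contradiction)
open import Relation.Binary.Bundles using (Setoid)
open import Relation.Binary.Structures using (IsEquivalence)
import Relation.Binary.Reasoning.Setoid
open import Relation.Binary.PropositionalEquality
  using (_≡_; refl; sym; trans; cong; cong₂; subst; module ≡-Reasoning)

module _ {n : ℕ} where

  act-≥ : (π : Permutation′ n) {k : ℕ} → ¬ k < n → act π k ≡ k
  act-≥ π {k} k≮n with k <? n
  ... | yes k<n = contradiction k<n k≮n
  ... | no _    = refl

  act-toℕ : (π : Permutation′ n) (j : Fin n) → act π (toℕ j) ≡ toℕ (π ⟨$⟩ʳ j)
  act-toℕ π j with toℕ j <? n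
  ... | yes j<n = cong (λ x → toℕ (π ⟨$⟩ʳ x)) (fromℕ<-toℕ j j<n)
  ... | no j≮n  = contradiction (toℕ<n j) j≮n

  act-id : ∀ k → act (P.id {n}) k ≡ k
  act-id k with k <? n
  ... | yes k<n = toℕ-fromℕ< k<n
  ... | no _    = refl

  act-∘ₚ : (ρ π : Permutation′ n) → ∀ k → act (ρ ∘ₚ π) k ≡ act π (act ρ k)
  act-∘ₚ ρ π k with k <? n
  ... | yes k<n = sym (act-toℕ π (ρ ⟨$⟩ʳ fromℕ< k<n))
  ... | no k≮n  = sym (act-≥ π k≮n)

  act-flip-act : (π : Permutation′ n) → ∀ k → act (flip π) (act π k) ≡ k
  act-flip-act π k with k <? n
  ... | yes k<n = begin
    act (flip π) (toℕ (π ⟨$⟩ʳ fromℕ< k<n)) ≡⟨ act-toℕ (flip π) _ ⟩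
    toℕ (flip π ⟨$⟩ʳ (π ⟨$⟩ʳ fromℕ< k<n))  ≡⟨ cong toℕ (inverseˡ π) ⟩
    toℕ (fromℕ< k<n)                        ≡⟨ toℕ-fromℕ< k<n ⟩
    k                                       ∎
    where open ≡-Reasoning
  ... | no k≮n = act-≥ (flip π) k≮n

  act-act-flip : (π : Permutation′ n) → ∀ k → act π (act (flip π) k) ≡ k
  act-act-flip π = act-flip-act (flip π)

  act-injective : (π : Permutation′ n) {a b : ℕ} → act π a ≡ act π b → a ≡ b
  act-injective π {a} {b} e =
    trans (sym (act-flip-act π a)) (trans (cong (act (flip π)) e) (act-flip-act π b))

  act-flip-flip : (π : Permutation′ n) → ∀ k → act (flip (flip π)) k ≡ act π k
  act-flip-flip π k = act-injective (flip π) (trans (act-act-flip (flip π) k) (sym (act-flip-act π k)))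

act-ext : {n m : ℕ} (n≤m : n ≤ m) (π : Permutation′ n) → ∀ k → act (ext n≤m π) k ≡ act π k
act-ext {n} {m} n≤m π k with k <? m
... | yes k<m = trans (ext-fun-toℕ (fromℕ< k<m)) (cong (act π) (toℕ-fromℕ< k<m))
  where
  ext-fun-toℕ : (i : Fin m) → toℕ (ext-fun n≤m (π ⟨$⟩ʳ_) i) ≡ act π (toℕ i)
  ext-fun-toℕ i with toℕ i <? n
  ... | yes i<n = toℕ-inject≤ (π ⟨$⟩ʳ fromℕ< i<n) n≤m
  ... | no _    = refl
... | no k≮m = sym (act-≥ π (λ k<n → k≮m (<-≤-trans k<n n≤m)))

act-flip-cong : {n m : ℕ} (π : Permutation′ n) (π′ : Permutation′ m) →
                (∀ k → act π k ≡ act π′ k) → ∀ k → act (flip π) k ≡ act (flip π′) k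
act-flip-cong π π′ π≗π′ k = begin
  act (flip π) k                              ≡⟨ cong (act (flip π)) (act-act-flip π′ k) ⟨
  act (flip π) (act π′ (act (flip π′) k))     ≡⟨ cong (act (flip π)) (π≗π′ _) ⟨
  act (flip π) (act π (act (flip π′) k))      ≡⟨ act-flip-act π _ ⟩
  act (flip π′) k                             ∎
  where open ≡-Reasoning

castEq⇒actEq : {n m : ℕ} (π : Permutation′ n) (ρ : Permutation′ m) (e : n ≡ m) →
               (∀ j → toℕ (π ⟨$⟩ʳ j) ≡ toℕ (ρ ⟨$⟩ʳ cast e j)) → ∀ k → act π k ≡ act ρ k
castEq⇒actEq {n} π ρ refl π≗ρ k with k <? n
... | yes k<n = trans (π≗ρ (fromℕ< k<n)) (cong (λ x → toℕ (ρ ⟨$⟩ʳ x)) (cast-is-id refl (fromℕ< k<n)))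
... | no _    = refl

actEq⇒castEq : {n m : ℕ} (π : Permutation′ n) (ρ : Permutation′ m) (e : n ≡ m) →
               (∀ k → act π k ≡ act ρ k) → ∀ j → toℕ (π ⟨$⟩ʳ j) ≡ toℕ (ρ ⟨$⟩ʳ cast e j)
actEq⇒castEq π ρ refl π≗ρ j = begin
  toℕ (π ⟨$⟩ʳ j)          ≡⟨ act-toℕ π j ⟨
  act π (toℕ j)           ≡⟨ π≗ρ (toℕ j) ⟩
  act ρ (toℕ j)           ≡⟨ act-toℕ ρ j ⟩
  toℕ (ρ ⟨$⟩ʳ j)          ≡⟨ cong (λ x → toℕ (ρ ⟨$⟩ʳ x)) (cast-is-id refl j) ⟨
  toℕ (ρ ⟨$⟩ʳ cast refl j) ∎
  where open ≡-Reasoning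

-- Equality of permutation trees

record NodeAgree (w : List ℕ) (t u : PT) : Set where
  constructor agree
  field
    arity≡ : arity t w ≡ arity u w
    act≡   : ∀ k → act (label t w) k ≡ act (label u w) k
open NodeAgree

NodeAgree-refl : ∀ {w t} → NodeAgree w t t
NodeAgree-refl = agree refl (λ _ → refl)

NodeAgree-sym : ∀ {w t u} → NodeAgree w t u → NodeAgree w u t
NodeAgree-sym (agree e h) = agree (sym e) (λ k → sym (h k))

NodeAgree-trans : ∀ {w t m u} → NodeAgree w t m → NodeAgree w m u → NodeAgree w t u
NodeAgree-trans (agree e₁ h₁) (agree e₂ h₂) = agree (trans e₁ e₂) (λ k → trans (h₁ k) (h₂ k))

NodeAgree-unshift : ∀ {t u i w} → NodeAgree w (shift t i) (shift u i) → NodeAgree (i ∷ w) t u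
NodeAgree-unshift (agree e h) = agree e h

-- _≈T_ unfolds to a function type, from which Agda cannot infer the two trees.
infix 4 _≋_
record _≋_ (t u : PT) : Set where
  constructor mk≋
  field ≈T-of : t ≈T u
open _≋_

≋-at : ∀ {t u} → t ≋ u → ∀ w → w ∈T t → NodeAgree w t u
≋-at {t} {u} t≋u w w∈t with ≈T-of t≋u w w∈t
... | e , h = agree e (castEq⇒actEq (label t w) (label u w) e h)

≋-from-nodes : ∀ {t u} → (∀ w → w ∈T t → NodeAgree w t u) → t ≋ u
≋-from-nodes {t} {u} h = mk≋ λ w w∈t →
  arity≡ (h w w∈t) , actEq⇒castEq (label t w) (label u w) (arity≡ (h w w∈t)) (act≡ (h w w∈t))

≋-root : ∀ {t u} → t ≋ u → NodeAgree [] t u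
≋-root t≋u = ≋-at t≋u [] tt

≋-shift : ∀ {t u} → t ≋ u → ∀ i → i < arity t [] → shift t i ≋ shift u i
≋-shift t≋u i i<t = mk≋ λ w w∈ → ≈T-of t≋u (i ∷ w) (i<t , w∈)

≋-refl : ∀ {t} → t ≋ t
≋-refl = ≋-from-nodes λ _ _ → NodeAgree-refl

≡⇒≋ : ∀ {t u} → t ≡ u → t ≋ u
≡⇒≋ refl = ≋-refl

∈T-transport : ∀ w {t u} → t ≋ u → w ∈T t → w ∈T u
∈T-transport []      t≋u _            = tt
∈T-transport (i ∷ w) t≋u (i<t , w∈) =
  subst (i <_) (arity≡ (≋-root t≋u)) i<t , ∈T-transport w (≋-shift t≋u i i<t) w∈

∈T-reflect : ∀ w {t u} → t ≋ u → w ∈T u → w ∈T t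
∈T-reflect []      t≋u _            = tt
∈T-reflect (i ∷ w) t≋u (i<u , w∈) = i<t , ∈T-reflect w (≋-shift t≋u i i<t) w∈
  where i<t = subst (i <_) (sym (arity≡ (≋-root t≋u))) i<u

≋-sym : ∀ {t u} → t ≋ u → u ≋ t
≋-sym t≋u = ≋-from-nodes λ w w∈ → NodeAgree-sym (≋-at t≋u w (∈T-reflect w t≋u w∈))

≋-trans : ∀ {t m u} → t ≋ m → m ≋ u → t ≋ u
≋-trans t≋m m≋u =
  ≋-from-nodes λ w w∈ → NodeAgree-trans (≋-at t≋m w w∈) (≋-at m≋u w (∈T-transport w t≋m w∈))

≋-isEquivalence : IsEquivalence _≋_
≋-isEquivalence = record { refl = ≋-refl ; sym = ≋-sym ; trans = ≋-trans }

≋-setoid : Setoid _ _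
≋-setoid = record { isEquivalence = ≋-isEquivalence }

module ≋-Reasoning = Relation.Binary.Reasoning.Setoid ≋-setoid

module _ {I : Set} (l r : I → PT) (root : ∀ x → NodeAgree [] (l x) (r x))
         (step : ∀ x i → i < arity (l x) [] →
                 Σ I λ y → shift (l x) i ≋ l y × r y ≋ shift (r x) i) where

  private
    agree-below : ∀ w x → w ∈T l x → w ∈T r x × NodeAgree w (l x) (r x)
    agree-below []      x _            = tt , root x
    agree-below (i ∷ w) x (i<l , w∈) with step x i i<l
    ... | y , lx≋ly , ry≋rx with agree-below w y (∈T-transport w lx≋ly w∈)
    ...   | w∈ry , ly~ry =
      (subst (i <_) (arity≡ (root x)) i<l , ∈T-transport w ry≋rx w∈ry) ,
      NodeAgree-unshift {l x} {r x}
        (NodeAgree-trans (≋-at lx≋ly w w∈) (NodeAgree-trans ly~ry (≋-at ry≋rx w w∈ry)))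

  ≋-coinduction : ∀ x → l x ≋ r x
  ≋-coinduction x = ≋-from-nodes λ w w∈ → proj₂ (agree-below w x w∈)

sub-< : ∀ t i → i < arity t [] → sub t i ≡ shift t i
sub-< t i i<t with i <? arity t []
... | yes _   = refl
... | no i≮t  = contradiction i<t i≮t

sub-≮ : ∀ t i → ¬ i < arity t [] → sub t i ≡ ε̄
sub-≮ t i i≮t with i <? arity t []
... | yes i<t = contradiction i<t i≮t
... | no _    = refl

sub-elim : (P : PT → Set) → ∀ t i →
           (i < arity t [] → P (shift t i)) → (¬ i < arity t [] → P ε̄) → P (sub t i)
sub-elim P t i below beyond with i <? arity t []
... | yes i<t = below i<t
... | no i≮t  = beyond i≮t

sub-cong : ∀ {t u} → t ≋ u → ∀ i → sub t i ≋ sub u i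
sub-cong {t} {u} t≋u i = sub-elim (_≋ sub u i) t i
  (λ i<t → subst (shift t i ≋_) (sym (sub-< u i (subst (i <_) t~u i<t))) (≋-shift t≋u i i<t))
  (λ i≮t → subst (ε̄ ≋_) (sym (sub-≮ u i (λ i<u → i≮t (subst (i <_) (sym t~u) i<u)))) ≋-refl)
  where t~u = arity≡ (≋-root t≋u)

act-label-· : ∀ t u k → act (label (t · u) []) k ≡ act (label t []) (act (label u []) k)
act-label-· t u k = begin
  act (ext u≤ (label u []) ∘ₚ ext t≤ (label t [])) k      ≡⟨ act-∘ₚ (ext u≤ (label u [])) (ext t≤ (label t [])) k ⟩
  act (ext t≤ (label t [])) (act (ext u≤ (label u [])) k) ≡⟨ act-ext t≤ (label t []) _ ⟩
  act (label t []) (act (ext u≤ (label u [])) k)          ≡⟨ cong (act (label t [])) (act-ext u≤ (label u []) k) ⟩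
  act (label t []) (act (label u []) k)                   ∎
  where
  open ≡-Reasoning
  u≤ = m≤n⊔m (arity t []) (arity u [])
  t≤ = m≤m⊔n (arity t []) (arity u [])

-- shift (t · u) i is definitionally sub u i · sub t (act (label u []) i), and shift (t *) i
-- is sub t (act (flip (label t [])) i) *; the ≋-refl in the coinduction steps rely on this.
·-cong : ∀ {a a′ b b′} → a ≋ a′ → b ≋ b′ → a · b ≋ a′ · b′
·-cong a≋a′ b≋b′ = ≋-coinduction lhs rhs root step (related a≋a′ b≋b′)
  where
  record Related : Set where
    eta-equality
    constructor related
    field
      {a a′ b b′} : PT
      a≋ : a ≋ a′
      b≋ : b ≋ b′

  lhs rhs : Related → PT
  lhs x = Related.a x · Related.b x
  rhs x = Related.a′ x · Related.b′ x

  root : ∀ x → NodeAgree [] (lhs x) (rhs x)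
  root (related {a} {a′} {b} {b′} a≋ b≋) =
    agree (cong₂ _⊔_ (arity≡ (≋-root a≋)) (arity≡ (≋-root b≋))) λ k → begin
      act (label (a · b) []) k                ≡⟨ act-label-· a b k ⟩
      act (label a []) (act (label b []) k)   ≡⟨ act≡ (≋-root a≋) _ ⟩
      act (label a′ []) (act (label b []) k)  ≡⟨ cong (act (label a′ [])) (act≡ (≋-root b≋) k) ⟩
      act (label a′ []) (act (label b′ []) k) ≡⟨ act-label-· a′ b′ k ⟨
      act (label (a′ · b′) []) k              ∎
    where open ≡-Reasoning

  step : ∀ x i → i < arity (lhs x) [] → Σ Related λ y → shift (lhs x) i ≋ lhs y × rhs y ≋ shift (rhs x) i
  step (related {a} {a′} {b} {b′} a≋ b≋) i _ =
    related (sub-cong b≋ i) (sub-cong a≋ (act (label b []) i)) ,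
    ≋-refl ,
    ≡⇒≋ (cong (λ k → sub b′ i · sub a′ k) (act≡ (≋-root b≋) i))

*-cong : ∀ {a a′} → a ≋ a′ → a * ≋ a′ *
*-cong a≋a′ = ≋-coinduction lhs rhs root step (related a≋a′)
  where
  record Related : Set where
    eta-equality
    constructor related
    field
      {a a′} : PT
      a≋ : a ≋ a′

  lhs rhs : Related → PT
  lhs x = Related.a x *
  rhs x = Related.a′ x *

  flip≗ : ∀ x k → act (flip (label (Related.a x) [])) k ≡ act (flip (label (Related.a′ x) [])) k
  flip≗ (related {a} {a′} a≋) = act-flip-cong (label a []) (label a′ []) (act≡ (≋-root a≋))

  root : ∀ x → NodeAgree [] (lhs x) (rhs x)
  root x@(related a≋) = agree (arity≡ (≋-root a≋)) (flip≗ x)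

  step : ∀ x i → i < arity (lhs x) [] → Σ Related λ y → shift (lhs x) i ≋ lhs y × rhs y ≋ shift (rhs x) i
  step x@(related {a} {a′} a≋) i _ =
    related (sub-cong a≋ (act (flip (label a [])) i)) ,
    ≋-refl ,
    ≡⇒≋ (cong (λ k → sub a′ k *) (flip≗ x i))

-- Monoid laws

data Side : Set where
  left right : Side

opposite : Side → Side
opposite left  = right
opposite right = left

infixl 7 _·⟨_⟩_
_·⟨_⟩_ : PT → Side → PT → PT
g ·⟨ left ⟩  v = g · v
g ·⟨ right ⟩ v = v · g

sub-ε̄ : ∀ i → sub ε̄ i ≡ ε̄
sub-ε̄ i = sub-≮ ε̄ i (λ ())

identity : ∀ s t → ε̄ ·⟨ s ⟩ t ≋ t
identity s t = ≋-coinduction (λ (s , t) → ε̄ ·⟨ s ⟩ t) proj₂ root step (s , t)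
  where
  root : ∀ x → NodeAgree [] (ε̄ ·⟨ proj₁ x ⟩ proj₂ x) (proj₂ x)
  root (left , t)  = agree refl λ k → trans (act-label-· ε̄ t k) (act-id {0} _)
  root (right , t) = agree (⊔-identityʳ (arity t [])) λ k →
    trans (act-label-· t ε̄ k) (cong (act (label t [])) (act-id {0} k))

  step : ∀ x i → i < arity (ε̄ ·⟨ proj₁ x ⟩ proj₂ x) [] →
         Σ (Side × PT) λ y → shift (ε̄ ·⟨ proj₁ x ⟩ proj₂ x) i ≋ ε̄ ·⟨ proj₁ y ⟩ proj₂ y
                           × proj₂ y ≋ shift (proj₂ x) i
  step (left , t) i i<t =
    (right , shift t i) , ≡⇒≋ (cong₂ _·_ (sub-< t i i<t) (sub-ε̄ (act (label t []) i))) , ≋-refl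
  step (right , t) i i<t =
    (left , shift t i) ,
    ≡⇒≋ (cong₂ _·_ (sub-ε̄ i) (trans (cong (sub t) (act-id {0} i))
                                    (sub-< t i (subst (i <_) (⊔-identityʳ (arity t [])) i<t)))) ,
    ≋-refl

identityˡ : ∀ t → ε̄ · t ≋ t
identityˡ = identity left

identityʳ : ∀ t → t · ε̄ ≋ t
identityʳ = identity right

-- When neither factor has a child j, the left side is ε̄ but the right side is ε̄ · ε̄.
sub-· : ∀ t u j → sub (t · u) j ≋ sub u j · sub t (act (label u []) j)
sub-· t u j = sub-elim (_≋ sub u j · sub t (act (label u []) j)) (t · u) j
  (λ _ → ≋-refl)
  (λ j≮tu → subst (ε̄ ≋_) (sym (cong₂ _·_ (sub-u j≮tu) (sub-t j≮tu))) (≋-sym (identityˡ ε̄)))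
  where
  module _ (j≮tu : ¬ j < arity (t · u) []) where
    j≮u : ¬ j < arity u []
    j≮u j<u = j≮tu (<-≤-trans j<u (m≤n⊔m (arity t []) (arity u [])))
    sub-u : sub u j ≡ ε̄
    sub-u = sub-≮ u j j≮u
    sub-t : sub t (act (label u []) j) ≡ ε̄
    sub-t = trans (cong (sub t) (act-≥ (label u []) j≮u))
                  (sub-≮ t j (λ j<t → j≮tu (<-≤-trans j<t (m≤m⊔n (arity t []) (arity u [])))))

ε̄≋ε̄* : ε̄ ≋ ε̄ *
ε̄≋ε̄* = ≋-from-nodes λ { [] _ → agree refl λ k → trans (act-id {0} k) (sym (act-≥ (flip (P.id {0})) λ ()))
                       ; (i ∷ w) (() , _) }

sub-* : ∀ t j → sub (t *) j ≋ sub t (act (flip (label t [])) j) *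
sub-* t j = sub-elim (_≋ sub t (act (flip (label t [])) j) *) (t *) j
  (λ _ → ≋-refl)
  (λ j≮t → subst (ε̄ ≋_) (sym (cong _* (sub-t j≮t))) ε̄≋ε̄*)
  where
  sub-t : ¬ j < arity t [] → sub t (act (flip (label t [])) j) ≡ ε̄
  sub-t j≮t = trans (cong (sub t) (act-≥ (flip (label t [])) j≮t)) (sub-≮ t j j≮t)

bracket : Side → PT → PT → PT → PT
bracket left  t u v = (t · u) · v
bracket right t u v = t · (u · v)

shift-bracket : ∀ s t u v i →
                shift (bracket s t u v) i ≋
                bracket (opposite s) (sub v i) (sub u (act (label v []) i))
                        (sub t (act (label u []) (act (label v []) i)))
shift-bracket left  t u v i = ·-cong (≋-refl {sub v i}) (sub-· t u (act (label v []) i))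
shift-bracket right t u v i = ·-cong (sub-· u v i) (≡⇒≋ (cong (sub t) (act-label-· u v i)))

bracket-root : ∀ t u v → NodeAgree [] (bracket left t u v) (bracket right t u v)
bracket-root t u v = agree (⊔-assoc (arity t []) (arity u []) (arity v [])) λ k → begin
  act (label ((t · u) · v) []) k                        ≡⟨ act-label-· (t · u) v k ⟩
  act (label (t · u) []) (act (label v []) k)           ≡⟨ act-label-· t u _ ⟩
  act (label t []) (act (label u []) (act (label v []) k)) ≡⟨ cong (act (label t [])) (act-label-· u v k) ⟨
  act (label t []) (act (label (u · v) []) k)           ≡⟨ act-label-· t (u · v) k ⟨
  act (label (t · (u · v)) []) k                        ∎
  where open ≡-Reasoning

assoc : ∀ t u v → (t · u) · v ≋ t · (u · v)
assoc t u v = ≋-coinduction lhs rhs root step (left , t , u , v)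
  where
  lhs rhs : Side × PT × PT × PT → PT
  lhs (s , t , u , v) = bracket s t u v
  rhs (s , t , u , v) = bracket (opposite s) t u v

  root : ∀ x → NodeAgree [] (lhs x) (rhs x)
  root (left  , t , u , v) = bracket-root t u v
  root (right , t , u , v) = NodeAgree-sym (bracket-root t u v)

  step : ∀ x i → i < arity (lhs x) [] → Σ (Side × PT × PT × PT) λ y → shift (lhs x) i ≋ lhs y × rhs y ≋ shift (rhs x) i
  step (s , t , u , v) i _ =
    (opposite s , sub v i , sub u (act (label v []) i) , sub t (act (label u []) (act (label v []) i))) ,
    shift-bracket s t u v i ,
    ≋-sym (shift-bracket (opposite s) t u v i)

-- Inverse laws

involution : ∀ t → t * * ≋ t
involution = ≋-coinduction (λ t → t * *) (λ t → t)
  (λ t → agree refl (act-flip-flip (label t [])))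
  (λ t i i<t → shift t i , below t i i<t , ≋-refl)
  where
  below : ∀ t i → i < arity t [] → shift (t * *) i ≋ shift t i * *
  below t i i<t = begin
    sub (t *) (act (flip (flip π)) i) *                ≈⟨ *-cong (sub-* t (act (flip (flip π)) i)) ⟩
    sub t (act (flip π) (act (flip (flip π)) i)) * *   ≡⟨ cong (λ k → sub t k * *) (act-act-flip (flip π) i) ⟩
    sub t i * *                                        ≡⟨ cong (λ s → s * *) (sub-< t i i<t) ⟩
    shift t i * *                                      ∎
    where
    open ≋-Reasoning
    π = label t []

act-flip-label-· : ∀ t u k →
                   act (flip (label (t · u) [])) k ≡ act (flip (label u [])) (act (flip (label t [])) k)
act-flip-label-· t u k = act-injective (label (t · u) []) (begin
  act πtu (act (flip πtu) k)                               ≡⟨ act-act-flip πtu k ⟩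
  k                                                        ≡⟨ act-act-flip πt k ⟨
  act πt (act (flip πt) k)                                 ≡⟨ cong (act πt) (act-act-flip πu _) ⟨
  act πt (act πu (act (flip πu) (act (flip πt) k)))        ≡⟨ act-label-· t u _ ⟨
  act πtu (act (flip πu) (act (flip πt) k))                ∎)
  where
  open ≡-Reasoning
  πt = label t []
  πu = label u []
  πtu = label (t · u) []

antihom : ∀ t u → (t · u) * ≋ u * · t *
antihom t u = ≋-coinduction (λ (t , u) → (t · u) *) (λ (t , u) → u * · t *)
  (λ (t , u) → agree (⊔-comm (arity t []) (arity u [])) λ k →
     trans (act-flip-label-· t u k) (sym (act-label-· (u *) (t *) k)))
  (λ (t , u) i _ →
     (sub u (act (flip (label u [])) (act (flip (label t [])) i)) , sub t (act (flip (label t [])) i)) ,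
     below t u i ,
     ≋-sym (·-cong (sub-* t i) (sub-* u (act (flip (label t [])) i))))
  (t , u)
  where
  below : ∀ t u i → shift ((t · u) *) i ≋
                    (sub u (act (flip (label u [])) (act (flip (label t [])) i)) · sub t (act (flip (label t [])) i)) *
  below t u i =
    let πu = label u [] ; πtu = label (t · u) []
        i′ = act (flip (label t [])) i ; j = act (flip πu) i′
        i↦j = act-flip-label-· t u i
    in begin
    sub (t · u) (act (flip πtu) i) *                                   ≈⟨ *-cong (sub-· t u (act (flip πtu) i)) ⟩
    (sub u (act (flip πtu) i) · sub t (act πu (act (flip πtu) i))) *
      ≡⟨ cong _* (cong₂ _·_ (cong (sub u) i↦j) (cong (sub t) (trans (cong (act πu) i↦j) (act-act-flip πu i′)))) ⟩
    (sub u j · sub t i′) *                                             ∎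
    where open ≋-Reasoning

regular : ∀ t → (t · t *) · t ≋ t
regular = ≋-coinduction (λ t → (t · t *) · t) (λ t → t)
  (λ t → agree (arity-ttt t) (root t))
  (λ t i i<ttt → shift t i , below t i (subst (i <_) (arity-ttt t) i<ttt) , ≋-refl)
  where
  arity-ttt : ∀ t → arity ((t · t *) · t) [] ≡ arity t []
  arity-ttt t = trans (cong (_⊔ arity t []) (⊔-idem (arity t []))) (⊔-idem (arity t []))

  root : ∀ t k → act (label ((t · t *) · t) []) k ≡ act (label t []) k
  root t k = begin
    act (label ((t · t *) · t) []) k              ≡⟨ act-label-· (t · t *) t k ⟩
    act (label (t · t *) []) (act π k)            ≡⟨ act-label-· t (t *) _ ⟩
    act π (act (flip π) (act π k))                ≡⟨ cong (act π) (act-flip-act π k) ⟩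
    act π k                                       ∎
    where
    open ≡-Reasoning
    π = label t []

  below : ∀ t i → i < arity t [] → shift ((t · t *) · t) i ≋ (shift t i · shift t i *) · shift t i
  below t i i<t =
    let π = label t [] ; s = shift t i
        back : ∀ {k} → k ≡ i → sub t k ≡ s
        back k≡i = trans (cong (sub t) k≡i) (sub-< t i i<t)
    in begin
    sub t i · sub (t · t *) (act π i)
      ≈⟨ ·-cong (≋-refl {sub t i}) (sub-· t (t *) (act π i)) ⟩
    sub t i · (sub (t *) (act π i) · sub t (act (label (t *) []) (act π i)))
      ≈⟨ ·-cong (≋-refl {sub t i}) (·-cong (sub-* t (act π i)) (≋-refl {sub t (act (label (t *) []) (act π i))})) ⟩
    sub t i · (sub t (act (flip π) (act π i)) * · sub t (act (label (t *) []) (act π i)))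
      ≡⟨ cong₂ _·_ (back refl) (cong₂ _·_ (cong _* (back (act-flip-act π i))) (back (act-flip-act π i))) ⟩
    s · (s * · s)
      ≈⟨ assoc s (s *) s ⟨
    (s · s *) · s
      ∎
    where open ≋-Reasoning

-- Idempotents

record IdTree (t : PT) : Set where
  constructor idTree
  field label-id : ∀ w → w ∈T t → ∀ k → act (label t w) k ≡ k
open IdTree

IdTree-root : ∀ {t} → IdTree t → ∀ k → act (label t []) k ≡ k
IdTree-root h = label-id h [] tt

IdTree-root-· : ∀ {e f} → IdTree e → IdTree f → ∀ k → act (label (e · f) []) k ≡ k
IdTree-root-· {e} {f} ide idf k =
  trans (act-label-· e f k) (trans (IdTree-root ide (act (label f []) k)) (IdTree-root idf k))

IdTree-shift : ∀ {t} → IdTree t → ∀ i → i < arity t [] → IdTree (shift t i)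
IdTree-shift h i i<t = idTree λ w w∈ → label-id h (i ∷ w) (i<t , w∈)

IdTree-sub : ∀ {t} → IdTree t → ∀ i → IdTree (sub t i)
IdTree-sub {t} h i = sub-elim IdTree t i (IdTree-shift h i) (λ _ → idTree λ _ _ → act-id {0})

module _ {I : Set} (l : I → PT) (root : ∀ x k → act (label (l x) []) k ≡ k)
         (step : ∀ x i → i < arity (l x) [] → Σ I λ y → shift (l x) i ≋ l y) where

  private
    id-below : ∀ w x → w ∈T l x → ∀ k → act (label (l x) w) k ≡ k
    id-below []      x _            = root x
    id-below (i ∷ w) x (i<l , w∈) k with step x i i<l
    ... | y , lx≋ly = trans (act≡ (≋-at lx≋ly w w∈) k) (id-below w y (∈T-transport w lx≋ly w∈) k)

  IdTree-coinduction : ∀ x → IdTree (l x)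
  IdTree-coinduction x = idTree λ w → id-below w x

IdTree-·* : ∀ u → IdTree (u · u *)
IdTree-·* = IdTree-coinduction (λ u → u · u *)
  (λ u k → trans (act-label-· u (u *) k) (act-act-flip (label u []) k))
  (λ u i _ → let s = sub u (act (flip (label u [])) i) in
     s * , ·-cong (sub-* u i) (≋-sym (involution s)))

IdTree-comm : ∀ {e f} → IdTree e → IdTree f → e · f ≋ f · e
IdTree-comm e-id f-id = ≋-coinduction lhs rhs root step (both e-id f-id)
  where
  record Both : Set where
    eta-equality
    constructor both
    field
      {e f} : PT
      ide : IdTree e
      idf : IdTree f

  lhs rhs : Both → PT
  lhs x = Both.e x · Both.f x
  rhs x = Both.f x · Both.e x

  root : ∀ x → NodeAgree [] (lhs x) (rhs x)
  root (both {e} {f} ide idf) = agree (⊔-comm (arity e []) (arity f [])) λ k →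
    trans (IdTree-root-· ide idf k) (sym (IdTree-root-· idf ide k))

  step : ∀ x i → i < arity (lhs x) [] → Σ Both λ y → shift (lhs x) i ≋ lhs y × rhs y ≋ shift (rhs x) i
  step (both {e} {f} ide idf) i _ =
    both (IdTree-sub idf i) (IdTree-sub ide i) ,
    ≡⇒≋ (cong (λ k → sub f i · sub e k) (IdTree-root idf i)) ,
    ≡⇒≋ (cong (λ k → sub e i · sub f k) (sym (IdTree-root ide i)))

Idempotent : PT → Set
Idempotent t = t · t ≋ t

idempotent⇒IdTree : ∀ {t} → Idempotent t → IdTree t
idempotent⇒IdTree {t} tt≋t = IdTree-coinduction {Σ PT Idempotent} proj₁ root step (t , tt≋t)
  where
  root : ∀ x k → act (label (proj₁ x) []) k ≡ k
  root (t , tt≋t) k = act-injective (label t []) (trans (sym (act-label-· t t k)) (act≡ (≋-root tt≋t) k))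

  step : ∀ x i → i < arity (proj₁ x) [] → Σ (Σ PT Idempotent) λ y → shift (proj₁ x) i ≋ proj₁ y
  step x@(t , tt≋t) i i<t =
    (shift t i , (begin
      shift t i · shift t i                   ≡⟨ cong₂ _·_ (sub-< t i i<t) t-at-i ⟨
      shift (t · t) i                         ≈⟨ ≋-shift tt≋t i (<-≤-trans i<t (m≤m⊔n (arity t []) (arity t []))) ⟩
      shift t i                               ∎)) ,
    ≋-refl
    where
    open ≋-Reasoning
    t-at-i : sub t (act (label t []) i) ≡ shift t i
    t-at-i = trans (cong (sub t) (root x i)) (sub-< t i i<t)

IdTree⇒idempotent : ∀ {t} → IdTree t → Idempotent t
IdTree⇒idempotent {t} idt = ≋-coinduction {Σ PT IdTree} (λ (t , _) → t · t) proj₁ root step (t , idt)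
  where
  root : ∀ x → NodeAgree [] (proj₁ x · proj₁ x) (proj₁ x)
  root (t , idt) = agree (⊔-idem (arity t [])) λ k →
    trans (IdTree-root-· idt idt k) (sym (IdTree-root idt k))

  step : ∀ x i → i < arity (proj₁ x · proj₁ x) [] →
         Σ (Σ PT IdTree) λ y → shift (proj₁ x · proj₁ x) i ≋ proj₁ y · proj₁ y × proj₁ y ≋ shift (proj₁ x) i
  step (t , idt) i i<tt =
    (shift t i , IdTree-shift idt i i<t) ,
    ≡⇒≋ (cong₂ _·_ (sub-< t i i<t) (trans (cong (sub t) (IdTree-root idt i)) (sub-< t i i<t))) ,
    ≋-refl
    where i<t = subst (i <_) (⊔-idem (arity t [])) i<tt

-- Since the root label of v is the identity, the subtree of g·v below i is v_i·g_i, the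
-- factors now in the opposite order; this is why both sides are needed.
IdTree-cancel : ∀ s {g v h} → IdTree g → IdTree h → g ·⟨ s ⟩ v ≋ h → IdTree v
IdTree-cancel s g-id h-id g·v≋h = IdTree-coinduction Cancel.v root step (cancel s g-id h-id g·v≋h)
  where
  record Cancel : Set where
    eta-equality
    constructor cancel
    field
      side : Side
      {g v h} : PT
      idg : IdTree g
      idh : IdTree h
      gv≋h : g ·⟨ side ⟩ v ≋ h

  root : ∀ x k → act (label (Cancel.v x) []) k ≡ k
  root (cancel left {g} {v} {h} idg idh gv≋h) k = begin
    act (label v []) k                    ≡⟨ IdTree-root idg _ ⟨
    act (label g []) (act (label v []) k) ≡⟨ act-label-· g v k ⟨
    act (label (g · v) []) k              ≡⟨ act≡ (≋-root gv≋h) k ⟩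
    act (label h []) k                    ≡⟨ IdTree-root idh k ⟩
    k                                     ∎
    where open ≡-Reasoning
  root (cancel right {g} {v} {h} idg idh vg≋h) k = begin
    act (label v []) k                    ≡⟨ cong (act (label v [])) (IdTree-root idg k) ⟨
    act (label v []) (act (label g []) k) ≡⟨ act-label-· v g k ⟨
    act (label (v · g) []) k              ≡⟨ act≡ (≋-root vg≋h) k ⟩
    act (label h []) k                    ≡⟨ IdTree-root idh k ⟩
    k                                     ∎
    where open ≡-Reasoning

  step : ∀ x i → i < arity (Cancel.v x) [] → Σ Cancel λ y → shift (Cancel.v x) i ≋ Cancel.v y
  step x@(cancel left {g} {v} {h} idg idh gv≋h) i i<v =
    cancel right (IdTree-sub idg i) (IdTree-shift idh i i<h)
      (begin
        shift v i · sub g i                      ≡⟨ cong₂ _·_ (sub-< v i i<v) (cong (sub g) (root x i)) ⟨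
        shift (g · v) i                          ≈⟨ ≋-shift gv≋h i i<gv ⟩
        shift h i                                ∎) ,
    ≋-refl
    where
    open ≋-Reasoning
    i<gv = <-≤-trans i<v (m≤n⊔m (arity g []) (arity v []))
    i<h  = subst (i <_) (arity≡ (≋-root gv≋h)) i<gv
  step (cancel right {g} {v} {h} idg idh vg≋h) i i<v =
    cancel left (IdTree-sub idg i) (IdTree-shift idh i i<h)
      (begin
        sub g i · shift v i                      ≡⟨ cong (sub g i ·_) (trans (cong (sub v) (IdTree-root idg i)) (sub-< v i i<v)) ⟨
        shift (v · g) i                          ≈⟨ ≋-shift vg≋h i i<vg ⟩
        shift h i                                ∎) ,
    ≋-refl
    where
    open ≋-Reasoning
    i<vg = <-≤-trans i<v (m≤m⊔n (arity v []) (arity g []))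
    i<h  = subst (i <_) (arity≡ (≋-root vg≋h)) i<vg

E-unitary : ∀ {f v} → Idempotent f → (f · f *) · v ≋ f → Idempotent v
E-unitary {f} ff≋f ff*v≋f =
  IdTree⇒idempotent (IdTree-cancel left (IdTree-·* f) (idempotent⇒IdTree ff≋f) ff*v≋f)

theorem3p6 : IsEUnitaryInverseMonoid _≈T_ _·_ _* ε̄
theorem3p6 = record
  { isInverseMonoid = record
    { isMonoid = record
      { isSemigroup = record
        { isMagma = record
          { isEquivalence = record
            { refl  = ≈T-of ≋-refl
            ; sym   = λ {t} {u} h → ≈T-of (≋-sym (mk≋ {t} {u} h))
            ; trans = λ {t} {m} {u} h₁ h₂ → ≈T-of (≋-trans (mk≋ {t} {m} h₁) (mk≋ {m} {u} h₂))
            }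
          ; ∙-cong = λ {a} {a′} {b} {b′} h₁ h₂ → ≈T-of (·-cong (mk≋ {a} {a′} h₁) (mk≋ {b} {b′} h₂))
          }
        ; assoc = λ t u v → ≈T-of (assoc t u v)
        }
      ; identity = (λ t → ≈T-of (identityˡ t)) , (λ t → ≈T-of (identityʳ t))
      }
    ; ⋆-cong     = λ {a} {a′} h → ≈T-of (*-cong (mk≋ {a} {a′} h))
    ; involution = λ t → ≈T-of (involution t)
    ; antihom    = λ t u → ≈T-of (antihom t u)
    ; regular    = λ t → ≈T-of (regular t)
    ; idem-comm  = λ u v → ≈T-of (IdTree-comm (IdTree-·* u) (IdTree-·* v))
    }
  ; eUnitary = λ f v ff≈f ff*v≈f → ≈T-of (E-unitary {f} {v} (mk≋ ff≈f) (mk≋ ff*v≈f))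
  }
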